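{- Let $\mathbb{V}=U\oplus W$ be an $n$-dimensional vector space ($n\ge 2$) over a finite field $\mathcal{F}$ with $q$ elements, where $U$ and $W$ are nonzero subspaces. Then the minimum degree $\delta$ of the direct sum graph $\Gamma_{U\oplus W}(\mathbb{V})$ is $(q-1)^2q^{n-2}-1$.
   Context: Let $\dim U=r$, $\dim W=s$, $r+s=n$. Fix a basis $\{\alpha_1,\dots,\alpha_r\}$ of $U$ and a basis $\{\beta_1,\dots,\beta_s\}$ of $W$; every $x\in\mathbb{V}$ is written uniquely as $x=\sum_i a_i\alpha_i+\sum_j b_j\beta_j$. The direct sum graph $\Gamma_{U\oplus W}(\mathbb{V})$ is the simple graph whose vertex set is $\{x=u+w: u\in U, w\in W, u\neq 0, w\neq 0\}$, in which two distinct vertices $x,y$ are adjacent iff there is an index $i$ such that the coefficient of $\alpha_i$ is nonzero in both $x$ and $y$, and there is an index $j$ such that the coefficient of $\beta_j$ is nonzero in both $x$ and $y$. -}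

module Defs where

open import Level using (0ℓ)
open import Data.Nat using (ℕ; _≤_)
open import Data.Fin using (Fin)
open import Data.Vec using (Vec; lookup)
open import Data.Bool using (Bool; true; false; not; _∧_; _∨_; T)
open import Data.Product using (Σ; Σ-syntax; _×_; _,_; proj₁; proj₂; ∃-syntax)
open import Data.Empty using (⊥)
open import Relation.Nullary using (¬_)
open import Relation.Nullary.Decidable using (⌊_⌋)
open import Relation.Binary.PropositionalEquality using (_≡_)
open import Relation.Binary.Definitions using (DecidableEquality)
open import Algebra.Structures using (IsCommutativeRing)
open import Function.Bundles using (_↔_)

record FiniteField (q : ℕ) : Set₁ where
  field
    Carrier  : Set
    _+_ _*_  : Carrier → Carrier → Carrier
    -_       : Carrier → Carrier
    0# 1#    : Carrier
    isCommutativeRing : IsCommutativeRing _≡_ _+_ _*_ -_ 0# 1#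
    0≢1      : ¬ (0# ≡ 1#)
    inverse  : (a : Carrier) → ¬ (a ≡ 0#) → Σ[ b ∈ Carrier ] (a * b ≡ 1#)
    _≟_      : DecidableEquality Carrier
    card     : Carrier ↔ Fin q

module DirectSumGraph {q : ℕ} (F : FiniteField q) (r s : ℕ) where
  open FiniteField F

  nz : Carrier → Bool
  nz a = not ⌊ a ≟ 0# ⌋

  anyFin : {m : ℕ} → (Fin m → Bool) → Bool
  anyFin {ℕ.zero}  f = false
  anyFin {ℕ.suc m} f = f Fin.zero ∨ anyFin (λ i → f (Fin.suc i))

  nonzeroVec : {m : ℕ} → Vec Carrier m → Bool
  nonzeroVec v = anyFin (λ i → nz (lookup v i))

  -- vectors in V = U ⊕ W, in coordinates w.r.t. the fixed bases α (of U) and β (of W)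
  Vect : Set
  Vect = Vec Carrier r × Vec Carrier s

  vecEq : {m : ℕ} → Vec Carrier m → Vec Carrier m → Bool
  vecEq u v = not (anyFin (λ i → not ⌊ lookup u i ≟ lookup v i ⌋))

  isVertex : Vect → Bool
  isVertex (a , b) = nonzeroVec a ∧ nonzeroVec b

  Vertex : Set
  Vertex = Σ[ x ∈ Vect ] T (isVertex x)

  adj : Vect → Vect → Bool
  adj (a , b) (a' , b') =
    not (vecEq a a' ∧ vecEq b b')
    ∧ anyFin (λ i → nz (lookup a i) ∧ nz (lookup a' i))
    ∧ anyFin (λ j → nz (lookup b j) ∧ nz (lookup b' j))

  Adjacent : Vertex → Vertex → Set
  Adjacent x y = T (adj (proj₁ x) (proj₁ y))

  Nbhd : Vertex → Set
  Nbhd x = Σ[ y ∈ Vertex ] Adjacent x y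

  HasDegree : Vertex → ℕ → Set
  HasDegree x d = Fin d ↔ Nbhd x

  IsMinDegree : ℕ → Set
  IsMinDegree δ = (∃[ x ] HasDegree x δ) × (∀ x d → HasDegree x d → δ ≤ d)

{-# OPTIONS --safe #-}
-- Every vertex x has a nonzero α_i- and a nonzero β_j-coefficient for some i, j, and every other
-- vector with nonzero α_i- and β_j-coefficients is adjacent to x.  There are
-- (q-1)·q^(r-1) · (q-1)·q^(s-1) such vectors, so deg x ≥ (q-1)²q^(n-2) - 1.  For x₀ = α₁ + β₁ the
-- α- and β-supports are single coordinates, so these are all of its neighbours and equality holds.
module Submission where

open import Defs
open import Data.Nat using (ℕ; _≤_; _+_; _*_; _∸_; _^_; zero; suc)
open import Data.Nat.Properties using (+-suc; ^-distribˡ-+-*)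
open import Data.Nat.Tactic.RingSolver using (solve-∀)
open import Data.Fin using (Fin; punchIn; punchOut)
import Data.Fin as Fin
open import Data.Fin.Properties
  using (¬Fin0; *↔×; punchInᵢ≢i; punchOut-cong; punchOut-punchIn; punchIn-punchOut; injective⇒≤)
open import Data.Vec using (Vec; []; _∷_; lookup; insertAt; removeAt; replicate; tabulate)
open import Data.Vec.Properties
  using (insertAt-lookup; removeAt-insertAt; insertAt-removeAt; lookup-replicate; tabulate∘lookup; tabulate-cong)
open import Data.Bool using (Bool; true; false; not; _∧_; T)
open import Data.Bool.Properties using (T-irrelevant; T-∧; T-∨)
open import Data.Product using (Σ; _×_; _,_; proj₁; proj₂; ∃-syntax)
open import Data.Product.Function.NonDependent.Propositional using (_×-↔_)
open import Data.Sum using (inj₁; inj₂)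
open import Data.Empty using (⊥-elim)
open import Function using (_∘_)
open import Function.Bundles using (_↔_; _↣_; Inverse; Injection; Equivalence; mk↔ₛ′; mk↣)
open import Function.Properties.Inverse using (↔-sym; ↔-trans; ↔⇒↣)
open import Function.Related.Propositional using (module EquationalReasoning; Kind)
open import Relation.Binary.PropositionalEquality
open import Relation.Nullary using (¬_; Irrelevant)
open import Relation.Nullary.Decidable using (⌊_⌋; toWitness; fromWitness; toWitnessFalse; fromWitnessFalse; decidable-stable)

open Inverse using (to; from; strictlyInverseˡ; strictlyInverseʳ)

T-not⇒¬T : ∀ {b} → T (not b) → ¬ T b
T-not⇒¬T {false} _ ()

¬T⇒T-not : ∀ {b} → ¬ T b → T (not b)
¬T⇒T-not {false} _  = _
¬T⇒T-not {true}  ¬t = ¬t _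

proj₁-injective : {A : Set} {B : A → Set} → (∀ a → Irrelevant (B a)) →
                  {u v : Σ A B} → proj₁ u ≡ proj₁ v → u ≡ v
proj₁-injective irr {a , p} {.a , q} refl = cong (a ,_) (irr a p q)

module _ {A : Set} (_==_ : A → A → Bool)
         (==⇒≡ : ∀ {a b} → T (a == b) → a ≡ b) (==-refl : ∀ a → T (a == a)) where

  removeOne↔ : ∀ {N} → A ↔ Fin N → (a : A) → Σ A (λ b → T (not (a == b))) ↔ Fin (N ∸ 1)
  removeOne↔ {zero}  e a = ⊥-elim (¬Fin0 (to e a))
  removeOne↔ {suc N} e a = mk↔ₛ′ out into out∘into into∘out
    where
    distinct : ∀ {b} → T (not (a == b)) → to e a ≢ to e b
    distinct {b} a≠b ea≡eb = T-not⇒¬T a≠b (subst (λ c → T (a == c)) a≡b (==-refl a))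
      where
      a≡b : a ≡ b
      a≡b = Injection.injective (↔⇒↣ e) ea≡eb

    out : Σ A (λ b → T (not (a == b))) → Fin N
    out (b , a≠b) = punchOut (distinct a≠b)

    into : Fin N → Σ A (λ b → T (not (a == b)))
    into k = from e (punchIn (to e a) k) , ¬T⇒T-not (λ a=b → punchInᵢ≢i (to e a) k (sym (begin
      to e a                             ≡⟨ cong (to e) (==⇒≡ a=b) ⟩
      to e (from e (punchIn (to e a) k)) ≡⟨ strictlyInverseˡ e _ ⟩
      punchIn (to e a) k                 ∎)))
      where open ≡-Reasoning

    out∘into : ∀ k → out (into k) ≡ k
    out∘into k = trans (punchOut-cong (to e a) (strictlyInverseˡ e _)) (punchOut-punchIn (to e a))

    into∘out : ∀ y → into (out y) ≡ y
    into∘out (b , a≠b) = proj₁-injective (λ _ → T-irrelevant)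
      (trans (cong (from e) (punchIn-punchOut (distinct a≠b))) (strictlyInverseʳ e b))

Vec↔Fin^ : {A : Set} {q : ℕ} → A ↔ Fin q → ∀ m → Vec A m ↔ Fin (q ^ m)
Vec↔Fin^ e zero = mk↔ₛ′ (λ _ → Fin.zero) (λ _ → [])
  (λ { Fin.zero → refl ; (Fin.suc ()) }) (λ { [] → refl })
Vec↔Fin^ {A} {q} e (suc m) = begin
  Vec A (suc m)           ↔⟨ ∷↔× ⟩
  (A × Vec A m)           ↔⟨ e ×-↔ Vec↔Fin^ e m ⟩
  (Fin q × Fin (q ^ m))   ↔⟨ *↔× ⟨
  Fin (q * q ^ m)         ∎
  where
  open EquationalReasoning
  ∷↔× : Vec A (suc m) ↔ (A × Vec A m)
  ∷↔× = mk↔ₛ′ (λ { (x ∷ v) → x , v }) (λ (x , v) → x ∷ v) (λ _ → refl) (λ { (x ∷ v) → refl })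

Σ-lookup↔ : {A : Set} (p : A → Bool) {m : ℕ} (i : Fin (suc m)) →
            Σ (Vec A (suc m)) (λ v → T (p (lookup v i))) ↔ (Σ A (T ∘ p) × Vec A m)
Σ-lookup↔ p i = mk↔ₛ′
  (λ (v , pv) → (lookup v i , pv) , removeAt v i)
  (λ ((x , px) , w) → insertAt w i x , subst (T ∘ p) (sym (insertAt-lookup w i x)) px)
  (λ ((x , px) , w) → cong₂ _,_ (proj₁-injective (λ _ → T-irrelevant) (insertAt-lookup w i x))
                                (removeAt-insertAt w i x))
  (λ (v , _) → proj₁-injective (λ _ → T-irrelevant) (insertAt-removeAt v i))

module Graph {q : ℕ} (F : FiniteField q) (r s : ℕ) where
  open FiniteField F using (Carrier; 0#; 1#; 0≢1; _≟_; card)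
  open DirectSumGraph F r s

  nz-1# : T (nz 1#)
  nz-1# = fromWitnessFalse (0≢1 ∘ sym)

  Nonzero : Set
  Nonzero = Σ Carrier (T ∘ nz)

  -- The equality test is flipped so that removing 0# leaves exactly the c with nz c.
  Nonzero↔ : Nonzero ↔ Fin (q ∸ 1)
  Nonzero↔ = removeOne↔ (λ a b → ⌊ b ≟ a ⌋) (sym ∘ toWitness) (λ _ → fromWitness refl) card 0#

  anyFin⁺ : ∀ {m} (f : Fin m → Bool) (i : Fin m) → T (f i) → T (anyFin f)
  anyFin⁺ f Fin.zero    fi = Equivalence.from T-∨ (inj₁ fi)
  anyFin⁺ f (Fin.suc i) fi = Equivalence.from T-∨ (inj₂ (anyFin⁺ (f ∘ Fin.suc) i fi))

  anyFin⁻ : ∀ {m} (f : Fin m → Bool) → T (anyFin f) → ∃[ i ] T (f i)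
  anyFin⁻ {suc m} f h with Equivalence.to T-∨ h
  ... | inj₁ f0 = Fin.zero , f0
  ... | inj₂ fs = let (i , fi) = anyFin⁻ (f ∘ Fin.suc) fs in Fin.suc i , fi

  vecEq-refl : ∀ {m} (u : Vec Carrier m) → T (vecEq u u)
  vecEq-refl u = ¬T⇒T-not λ h →
    let (i , ui≢ui) = anyFin⁻ (λ i → not ⌊ lookup u i ≟ lookup u i ⌋) h in toWitnessFalse ui≢ui refl

  vecEq⇒≡ : ∀ {m} (u v : Vec Carrier m) → T (vecEq u v) → u ≡ v
  vecEq⇒≡ u v h = begin
    u                   ≡⟨ tabulate∘lookup u ⟨
    tabulate (lookup u) ≡⟨ tabulate-cong pointwise ⟩
    tabulate (lookup v) ≡⟨ tabulate∘lookup v ⟩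
    v                   ∎
    where
    open ≡-Reasoning
    pointwise : ∀ i → lookup u i ≡ lookup v i
    pointwise i = decidable-stable (lookup u i ≟ lookup v i)
      (λ ui≢vi → T-not⇒¬T h (anyFin⁺ _ i (fromWitnessFalse ui≢vi)))

  vectEq : Vect → Vect → Bool
  vectEq (a , b) (a' , b') = vecEq a a' ∧ vecEq b b'

  vectEq-refl : ∀ x → T (vectEq x x)
  vectEq-refl (a , b) = Equivalence.from T-∧ (vecEq-refl a , vecEq-refl b)

  vectEq⇒≡ : ∀ x y → T (vectEq x y) → x ≡ y
  vectEq⇒≡ (a , b) (a' , b') h =
    let (a≡a' , b≡b') = Equivalence.to T-∧ h in cong₂ _,_ (vecEq⇒≡ a a' a≡a') (vecEq⇒≡ b b' b≡b')

  InSupport : Fin r → Fin s → Vect → Set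
  InSupport i j (a , b) = T (nz (lookup a i)) × T (nz (lookup b j))

  Support : Fin r → Fin s → Set
  Support i j = Σ Vect (InSupport i j)

  InSupport-irrelevant : ∀ {i j} x → Irrelevant (InSupport i j x)
  InSupport-irrelevant _ (p , q) (p' , q') = cong₂ _,_ (T-irrelevant p p') (T-irrelevant q q')

  support⇒vertex : ∀ {i j} x → InSupport i j x → T (isVertex x)
  support⇒vertex {i} {j} (a , b) (ai , bj) =
    Equivalence.from T-∧ (anyFin⁺ _ i ai , anyFin⁺ _ j bj)

  Others : ∀ {i j} → Support i j → Set
  Others {i} {j} (x , _) = Σ (Support i j) (λ y → T (not (vectEq x (proj₁ y))))

  Others↔ : ∀ {i j M} → Support i j ↔ Fin M → (x : Support i j) → Others x ↔ Fin (M ∸ 1)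
  Others↔ = removeOne↔ (λ x y → vectEq (proj₁ x) (proj₁ y))
    (λ {x} {y} x=y → proj₁-injective InSupport-irrelevant (vectEq⇒≡ (proj₁ x) (proj₁ y) x=y))
    (vectEq-refl ∘ proj₁)

  distinct-in-support⇒adjacent : ∀ {i j} x y → InSupport i j x → InSupport i j y →
                                 T (not (vectEq x y)) → T (adj x y)
  distinct-in-support⇒adjacent {i} {j} (a , b) (a' , b') (ai , bj) (a'i , b'j) x≠y =
    Equivalence.from T-∧ (x≠y , Equivalence.from T-∧
      ( anyFin⁺ (λ k → nz (lookup a k) ∧ nz (lookup a' k)) i (Equivalence.from T-∧ (ai , a'i))
      , anyFin⁺ (λ k → nz (lookup b k) ∧ nz (lookup b' k)) j (Equivalence.from T-∧ (bj , b'j))))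

  Others↣Nbhd : ∀ {i j} (x : Vertex) (hx : InSupport i j (proj₁ x)) → Others (proj₁ x , hx) ↣ Nbhd x
  Others↣Nbhd v@(x , _) hx = mk↣ {to = neighbour}
    λ eq → proj₁-injective (λ _ → T-irrelevant)
             (proj₁-injective InSupport-irrelevant (cong (proj₁ ∘ proj₁) eq))
    where
    neighbour : Others (x , hx) → Nbhd v
    neighbour ((y , hy) , x≠y) = (y , support⇒vertex y hy) , distinct-in-support⇒adjacent x y hx hy x≠y

  degree-lower-bound : ∀ {M} → (∀ i j → Support i j ↔ Fin M) → ∀ x d → HasDegree x d → M ∸ 1 ≤ d
  degree-lower-bound {M} Support↔ x@((a , b) , vx) d x-deg
    with anyFin⁻ (λ k → nz (lookup a k)) (proj₁ (Equivalence.to T-∧ vx))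
       | anyFin⁻ (λ k → nz (lookup b k)) (proj₂ (Equivalence.to T-∧ vx))
  ... | i , ai | j , bj = injective⇒≤ (Injection.injective embedding)
    where
    open EquationalReasoning {k = Kind.injection}
    embedding : Fin (M ∸ 1) ↣ Fin d
    embedding = begin
      Fin (M ∸ 1)                ↔⟨ Others↔ (Support↔ i j) ((a , b) , ai , bj) ⟨
      Others ((a , b) , ai , bj) ∼⟨ Others↣Nbhd x (ai , bj) ⟩
      Nbhd x                     ↔⟨ x-deg ⟨
      Fin d                      ∎

  e₀ : ∀ {m} → Vec Carrier (suc m)
  e₀ = 1# ∷ replicate _ 0#

  sharesSupport-e₀⇒head-nonzero : ∀ {m} (v : Vec Carrier (suc m)) →
    T (anyFin (λ k → nz (lookup e₀ k) ∧ nz (lookup v k))) → T (nz (lookup v Fin.zero))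
  sharesSupport-e₀⇒head-nonzero {m} v h with anyFin⁻ (λ k → nz (lookup (e₀ {m}) k) ∧ nz (lookup v k)) h
  ... | Fin.zero  , h₀ = proj₂ (Equivalence.to T-∧ h₀)
  ... | Fin.suc k , hₖ =
    ⊥-elim (toWitnessFalse (subst (T ∘ nz) (lookup-replicate k 0#) (proj₁ (Equivalence.to T-∧ hₖ))) refl)

support-size : ∀ q r' s' →
  (q ∸ 1) * q ^ r' * ((q ∸ 1) * q ^ s') ≡ (q ∸ 1) ^ 2 * q ^ (suc r' + suc s' ∸ 2)
support-size q r' s' = begin
  (q ∸ 1) * q ^ r' * ((q ∸ 1) * q ^ s') ≡⟨ regroup (q ∸ 1) (q ^ r') (q ^ s') ⟩
  (q ∸ 1) ^ 2 * (q ^ r' * q ^ s')       ≡⟨ cong ((q ∸ 1) ^ 2 *_) (^-distribˡ-+-* q r' s') ⟨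
  (q ∸ 1) ^ 2 * q ^ (r' + s')           ≡⟨ cong (λ n → (q ∸ 1) ^ 2 * q ^ (n ∸ 1)) (+-suc r' s') ⟨
  (q ∸ 1) ^ 2 * q ^ (suc r' + suc s' ∸ 2) ∎
  where
  open ≡-Reasoning
  regroup : ∀ a b c → a * b * (a * c) ≡ a * (a * 1) * (b * c)
  regroup = solve-∀

module Degrees {q : ℕ} (F : FiniteField q) (r' s' : ℕ) where
  open FiniteField F using (Carrier; card)
  open DirectSumGraph F (suc r') (suc s')
  open Graph F (suc r') (suc s')

  Support↔ : ∀ i j → Support i j ↔ Fin ((q ∸ 1) ^ 2 * q ^ (suc r' + suc s' ∸ 2))
  Support↔ i j = begin
    Support i j
      ↔⟨ split ⟩
    (NonzeroAt i × NonzeroAt j)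
      ↔⟨ Σ-lookup↔ nz i ×-↔ Σ-lookup↔ nz j ⟩
    ((Nonzero × Vec Carrier r') × (Nonzero × Vec Carrier s'))
      ↔⟨ (Nonzero↔ ×-↔ Vec↔Fin^ card r') ×-↔ (Nonzero↔ ×-↔ Vec↔Fin^ card s') ⟩
    ((Fin (q ∸ 1) × Fin (q ^ r')) × (Fin (q ∸ 1) × Fin (q ^ s')))
      ↔⟨ *↔× ×-↔ *↔× ⟨
    (Fin ((q ∸ 1) * q ^ r') × Fin ((q ∸ 1) * q ^ s'))
      ↔⟨ *↔× ⟨
    Fin ((q ∸ 1) * q ^ r' * ((q ∸ 1) * q ^ s'))
      ≡⟨ cong Fin (support-size q r' s') ⟩
    Fin ((q ∸ 1) ^ 2 * q ^ (suc r' + suc s' ∸ 2))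
      ∎
    where
    open EquationalReasoning
    NonzeroAt : ∀ {m} → Fin (suc m) → Set
    NonzeroAt {m} k = Σ (Vec Carrier (suc m)) (λ v → T (nz (lookup v k)))
    split : Support i j ↔ (NonzeroAt i × NonzeroAt j)
    split = mk↔ₛ′ (λ ((a , b) , ai , bj) → (a , ai) , (b , bj))
                  (λ ((a , ai) , (b , bj)) → (a , b) , ai , bj)
                  (λ _ → refl) (λ _ → refl)

  s₀ : Support Fin.zero Fin.zero
  s₀ = (e₀ , e₀) , nz-1# , nz-1#

  x₀ : Vertex
  x₀ = proj₁ s₀ , support⇒vertex {Fin.zero} {Fin.zero} (proj₁ s₀) (proj₂ s₀)

  Nbhd-x₀↔ : Nbhd x₀ ↔ Others s₀
  Nbhd-x₀↔ = mk↔ₛ′ to-others (Injection.to (Others↣Nbhd x₀ (proj₂ s₀)))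
    (λ _ → proj₁-injective (λ _ → T-irrelevant) (proj₁-injective InSupport-irrelevant refl))
    (λ _ → proj₁-injective (λ _ → T-irrelevant) (proj₁-injective (λ _ → T-irrelevant) refl))
    where
    to-others : Nbhd x₀ → Others s₀
    to-others (((a , b) , _) , adjacent) =
      let (x₀≠y , shares)     = Equivalence.to T-∧ adjacent
          (sharesα , sharesβ) = Equivalence.to T-∧ shares
      in ((a , b) , sharesSupport-e₀⇒head-nonzero a sharesα , sharesSupport-e₀⇒head-nonzero b sharesβ) , x₀≠y

  x₀-degree : HasDegree x₀ ((q ∸ 1) ^ 2 * q ^ (suc r' + suc s' ∸ 2) ∸ 1)
  x₀-degree = ↔-sym (↔-trans Nbhd-x₀↔ (Others↔ (Support↔ Fin.zero Fin.zero) s₀))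

theorem3p1 : (q : ℕ) (F : FiniteField q) (r s : ℕ) → 1 ≤ r → 1 ≤ s → 2 ≤ r + s →
    DirectSumGraph.IsMinDegree F r s ((q ∸ 1) ^ 2 * q ^ (r + s ∸ 2) ∸ 1)
theorem3p1 q F (suc r') (suc s') _ _ _ = (x₀ , x₀-degree) , degree-lower-bound Support↔
  where
  open Graph F (suc r') (suc s')
  open Degrees F r' s'
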